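{- For every integer $n\ge 1$ and every integer $k$, $$d_k(n+1)= d_{k-1}(n)+2d_k(n)-d_k(n-1).$$
   Context: A honeycomb strip of length $n$ consists of $n$ hexagons labelled $1,\dots,n$ in which hexagon $i$ is adjacent exactly with hexagons $i\pm1$ and $i\pm2$ (when these exist); equivalently its inner dual is the graph $P_n^2$ on vertices $1,\dots,n$ with $i\sim j$ iff $1\le|i-j|\le 2$. A division into $k$ pieces is a partition of the hexagons into $k$ blocks each inducing a connected subgraph of $P_n^2$. $d_k(n)$ denotes the number of such divisions of the strip of length $n$ into exactly $k$ pieces, for $n\ge1$; conventions: $d_k(n)=0$ for $k<1$ or $k>n$, and $d_1(0)=1$ (so $d_k(0)=0$ for $k\neq 1$). -}

module Defs where

open import Data.Nat using (ℕ; zero; suc; _≡ᵇ_; _≤ᵇ_; _<ᵇ_; ∣_-_∣)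
open import Data.Bool using (Bool; true; false; not; _∧_; _∨_; if_then_else_)
open import Data.List using (List; []; _∷_; [_]; map; concatMap; upTo; filterᵇ; length; zip)
open import Data.Bool.ListAction using (any; all)
open import Data.Product using (_,_; proj₁; proj₂)
open import Data.Integer using (ℤ; +_; -[1+_])

-- Hexagons are labelled 0,…,n-1 (a shift of the paper's 1,…,n).
-- Adjacency in the inner dual P_n^2 : i ∼ j iff 1 ≤ |i - j| ≤ 2.
adj : ℕ → ℕ → Bool
adj i j = not (i ≡ᵇ j) ∧ (∣ i - j ∣ ≤ᵇ 2)

elem : ℕ → List ℕ → Bool
elem x xs = any (λ y → x ≡ᵇ y) xs

-- A set partition of {0,…,n-1} is encoded by its canonical labelling
-- (restricted growth string): a word w of length n over {0,…,k-1} where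
-- w i is the index of the block containing i, blocks numbered in order of
-- their least element.  Every partition into k blocks has exactly one such code.

words : ℕ → ℕ → List (List ℕ)
words k zero = [ [] ]
words k (suc n) = concatMap (λ c → map (c ∷_) (words k n)) (upTo k)

canonicalFrom : ℕ → List ℕ → Bool
canonicalFrom m [] = true
canonicalFrom m (c ∷ w) =
  if c ≡ᵇ m then canonicalFrom (suc m) w
  else ((c <ᵇ m) ∧ canonicalFrom m w)

block : List ℕ → ℕ → List ℕ
block w c = map proj₁ (filterᵇ (λ p → proj₂ p ≡ᵇ c) (zip (upTo (length w)) w))

-- graph connectivity of the subgraph of P_n^2 induced by S, by iterated
-- reachability (|S| rounds suffice) from the first element of S
step : List ℕ → List ℕ → List ℕ
step S R = filterᵇ (λ s → elem s R ∨ any (adj s) R) S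

iter : ℕ → List ℕ → List ℕ → List ℕ
iter zero S R = R
iter (suc r) S R = iter r S (step S R)

connected : List ℕ → Bool
connected [] = false
connected (x ∷ S) = all (λ s → elem s R) (x ∷ S)
  where R = iter (length (x ∷ S)) (x ∷ S) [ x ]

-- w encodes a division into exactly k pieces: canonical, every label
-- 0,…,k-1 used (nonempty block), every block connected
validDivision : ℕ → List ℕ → Bool
validDivision k w = canonicalFrom 0 w ∧ all (λ c → connected (block w c)) (upTo k)

count : ℕ → ℕ → ℕ
count k n = length (filterᵇ (validDivision k) (words k n))

-- d k n = d_k(n), with the paper's conventions: 0 for k < 1 (and k > n),
-- d_1(0) = 1 and d_k(0) = 0 for k ≠ 1.
d : ℤ → ℕ → ℤ
d -[1+ _ ] n = + 0
d (+ k) zero = if k ≡ᵇ 1 then + 1 else + 0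
d (+ k) (suc n) = + count k (suc n)

module Submission where

-- A set of hexagons is connected in P_n^2 exactly when consecutive members differ by at most 2.
-- So, reading the canonical code of a division from left to right, each letter either opens a
-- new block or repeats one of the two previous letters, and every such word codes a division:
-- divisions are the words accepted by an automaton remembering the number of blocks opened and
-- the last two letters. Counting accepted words gives two sequences, ways₁ (last two letters
-- equal) and ways₂ (distinct), with ways₁(n+1) = ways₁(n) + ways₂′(n) and
-- ways₂(n+1) = ways₁(n) + ways₂(n) + ways₂′(n), where ′ means one block more already opened,
-- which is the same as one block fewer still to open. Eliminating ways₂ gives the recurrence.

open import Data.Bool using (Bool; true; false; T; T?; _∧_; _∨_; if_then_else_)
open import Data.Bool.ListAction using (any; all)
open import Data.Bool.Properties
  using (∨-zeroʳ; ∨-identityʳ; ∨-idem; ∧-zeroʳ; ∧-assoc; ∧-identityʳ; ∧-conicalˡ; ∧-conicalʳ)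
open import Data.Empty using (⊥-elim)
open import Data.Integer using (ℤ; +_; -[1+_]; _⊖_) renaming (_+_ to _+ℤ_; _-_ to _-ℤ_; _*_ to _*ℤ_)
open import Data.Integer.Properties using (pos-+; pos-*; [+m]-[+n]≡m⊖n; ⊖-≥)
open import Data.List
  using (List; []; _∷_; [_]; _++_; _∷ʳ_; map; concatMap; zip; upTo; filterᵇ; length; foldl)
open import Data.List.Membership.Propositional using (_∈_)
open import Data.List.Membership.Propositional.Properties using (∈-filter⁺; ∈-filter⁻; ∈-upTo⁺; ∈-upTo⁻)
open import Data.List.Properties
  using (foldl-∷ʳ; length-++; map-++; map-cong; filter-++; ++-identityʳ; upTo-∷ʳ; length-upTo)
open import Data.List.Relation.Binary.Subset.Propositional using (_⊆_)
open import Data.List.Relation.Unary.All as All using (All; []; _∷_)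
import Data.List.Relation.Unary.All.Properties as All
open import Data.List.Relation.Unary.AllPairs using (AllPairs; []; _∷_)
import Data.List.Relation.Unary.AllPairs.Properties as AllPairs
open import Data.List.Relation.Unary.Any using (here; there)
open import Data.List.Reverse using (Reverse; reverseView; []; _∶_∶ʳ_)
open import Data.Maybe using (Maybe; just; nothing)
open import Data.Nat using (ℕ; zero; suc; _+_; _*_; _∸_; _≤_; _<_; _≟_; _≤?_; _<?_; _≡ᵇ_; _≤ᵇ_; _<ᵇ_; z≤n; s≤s)
open import Data.Nat.ListAction using (sum)
open import Data.Nat.ListAction.Properties using (sum-++)
open import Data.Nat.Properties
  using (≤-refl; ≤-reflexive; ≤-trans; ≤-total; ≤-pred; <-irrefl; <-≤-trans; ≤-<-trans; <-cmp; <⇒≤; <⇒≢;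
         >⇒≢; <⇒≱; ≰⇒>; ≮⇒≥; ≤∧≢⇒<; n<1+n; n≤1+n; m<n⇒m<1+n; suc-injective; m≤m+n; m≤n+m;
         +-suc; +-comm; +-identityʳ; +-monoʳ-≤; +-monoˡ-≤; +-commutativeSemigroup;
         m+[n∸m]≡n; m+n∸m≡n; m+n∸n≡m; ∸-monoˡ-≤; m≤n⇒∣n-m∣≡n∸m)
open import Data.Nat.Solver using (module +-*-Solver)
open import Algebra.Properties.CommutativeSemigroup +-commutativeSemigroup using (interchange)
open import Data.Product using (∃-syntax; _×_; _,_; proj₁; proj₂)
open import Data.Sum using (_⊎_; inj₁; inj₂)
open import Defs
open import Function using (_∘_; id)
open import Relation.Binary.Definitions using (tri<; tri≈; tri>)
open import Relation.Binary.PropositionalEquality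
  using (_≡_; _≢_; refl; sym; trans; cong; cong₂; subst; module ≡-Reasoning)
open import Relation.Nullary using (¬_; proof; yes; no)
open import Relation.Nullary.Decidable using (dec-true; dec-false)
open import Relation.Nullary.Reflects using (Reflects; invert)

private variable
  b : Bool
  x y m n r : ℕ
  S R : List ℕ

module _ {P : Set} (p : Reflects P b) where
  reflects-true⇒ : b ≡ true → P
  reflects-true⇒ refl = invert p

  reflects-false⇒ : b ≡ false → ¬ P
  reflects-false⇒ refl = invert p

≡true⇒T : b ≡ true → T b
≡true⇒T refl = _

T⇒≡true : T b → b ≡ true
T⇒≡true {true} _ = refl

≡ᵇ-refl : ∀ n → (n ≡ᵇ n) ≡ true
≡ᵇ-refl n = dec-true (n ≟ n) refl

≡ᵇ-true⇒≡ : (m ≡ᵇ n) ≡ true → m ≡ n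
≡ᵇ-true⇒≡ = reflects-true⇒ (proof (_ ≟ _))

≤ᵇ-true⇒≤ : (m ≤ᵇ n) ≡ true → m ≤ n
≤ᵇ-true⇒≤ = reflects-true⇒ (proof (_ ≤? _))

≤ᵇ-false⇒> : (m ≤ᵇ n) ≡ false → n < m
≤ᵇ-false⇒> e = ≰⇒> (reflects-false⇒ (proof (_ ≤? _)) e)

∨-true⁻ : ∀ {b c} → b ∨ c ≡ true → b ≡ true ⊎ c ≡ true
∨-true⁻ {true} _ = inj₁ refl
∨-true⁻ {false} e = inj₂ e

module _ {A : Set} (f : A → Bool) where
  any-∈⁺ : ∀ {x xs} → x ∈ xs → f x ≡ true → any f xs ≡ true
  any-∈⁺ (here refl) fx rewrite fx = refl
  any-∈⁺ {xs = y ∷ _} (there x∈) fx rewrite any-∈⁺ x∈ fx = ∨-zeroʳ (f y)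

  any-∈⁻ : ∀ xs → any f xs ≡ true → ∃[ x ] x ∈ xs × f x ≡ true
  any-∈⁻ (y ∷ ys) e with f y in fy
  ... | true = y , here refl , fy
  ... | false = let x , x∈ , fx = any-∈⁻ ys e in x , there x∈ , fx

  all-∈⁺ : ∀ xs → (∀ {x} → x ∈ xs → f x ≡ true) → all f xs ≡ true
  all-∈⁺ [] _ = refl
  all-∈⁺ (y ∷ ys) h rewrite h (here refl) = all-∈⁺ ys (h ∘ there)

  all-∈-false : ∀ {x xs} → x ∈ xs → f x ≡ false → all f xs ≡ false
  all-∈-false (here refl) fx rewrite fx = refl
  all-∈-false {xs = y ∷ _} (there x∈) fx rewrite all-∈-false x∈ fx = ∧-zeroʳ (f y)

∈⇒elem : x ∈ S → elem x S ≡ true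
∈⇒elem {x} x∈ = any-∈⁺ (x ≡ᵇ_) x∈ (≡ᵇ-refl x)

elem⇒∈ : ∀ S → elem x S ≡ true → x ∈ S
elem⇒∈ {x} S e with any-∈⁻ (x ≡ᵇ_) S e
... | y , y∈ , x≡ᵇy = subst (_∈ S) (sym (≡ᵇ-true⇒≡ x≡ᵇy)) y∈

∉⇒elem-false : ¬ x ∈ S → elem x S ≡ false
∉⇒elem-false {x} {S} x∉ with elem x S in e
... | true = ⊥-elim (x∉ (elem⇒∈ S e))
... | false = refl

length-∷ʳ : ∀ (w : List ℕ) a → length (w ∷ʳ a) ≡ suc (length w)
length-∷ʳ w a = trans (length-++ w) (+-comm (length w) 1)

∷ʳ≢[] : ∀ (w : List ℕ) a → w ∷ʳ a ≢ []
∷ʳ≢[] [] a ()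
∷ʳ≢[] (_ ∷ _) a ()

zip-∷ʳ : ∀ {A B : Set} (xs : List A) (ys : List B) x y → length xs ≡ length ys →
  zip (xs ∷ʳ x) (ys ∷ʳ y) ≡ zip xs ys ∷ʳ (x , y)
zip-∷ʳ [] [] x y _ = refl
zip-∷ʳ (a ∷ xs) (b ∷ ys) x y e = cong ((a , b) ∷_) (zip-∷ʳ xs ys x y (suc-injective e))

filterᵇ-cong-All : ∀ {A : Set} {f g : A → Bool} {xs} → All (λ x → f x ≡ g x) xs →
  filterᵇ f xs ≡ filterᵇ g xs
filterᵇ-cong-All [] = refl
filterᵇ-cong-All {g = g} {x ∷ _} (fx≡gx ∷ rest) rewrite fx≡gx with g x
... | true = cong (x ∷_) (filterᵇ-cong-All rest)
... | false = filterᵇ-cong-All rest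

filterᵇ-none : ∀ {A : Set} {f : A → Bool} → (∀ x → f x ≡ false) → ∀ xs → filterᵇ f xs ≡ []
filterᵇ-none f≡false [] = refl
filterᵇ-none f≡false (x ∷ xs) rewrite f≡false x = filterᵇ-none f≡false xs

length-filterᵇ-concatMap : ∀ {A B : Set} (f : B → Bool) (g : A → List B) xs →
  length (filterᵇ f (concatMap g xs)) ≡ sum (map (λ x → length (filterᵇ f (g x))) xs)
length-filterᵇ-concatMap f g [] = refl
length-filterᵇ-concatMap f g (x ∷ xs) = begin
  length (filterᵇ f (g x ++ concatMap g xs))
    ≡⟨ cong length (filter-++ (T? ∘ f) (g x) (concatMap g xs)) ⟩
  length (filterᵇ f (g x) ++ filterᵇ f (concatMap g xs))
    ≡⟨ length-++ (filterᵇ f (g x)) ⟩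
  length (filterᵇ f (g x)) + length (filterᵇ f (concatMap g xs))
    ≡⟨ cong (_+_ (length (filterᵇ f (g x)))) (length-filterᵇ-concatMap f g xs) ⟩
  sum (map (λ x → length (filterᵇ f (g x))) (x ∷ xs)) ∎
  where open ≡-Reasoning

length-filterᵇ-map : ∀ {A B : Set} (f : B → Bool) (g : A → B) xs →
  length (filterᵇ f (map g xs)) ≡ length (filterᵇ (f ∘ g) xs)
length-filterᵇ-map f g [] = refl
length-filterᵇ-map f g (x ∷ xs) with f (g x)
... | true = cong suc (length-filterᵇ-map f g xs)
... | false = length-filterᵇ-map f g xs

sum-upTo-suc : ∀ (f : ℕ → ℕ) k → sum (map f (upTo (suc k))) ≡ sum (map f (upTo k)) + f k
sum-upTo-suc f k = begin
  sum (map f (upTo (suc k)))        ≡⟨ cong (sum ∘ map f) (sym (upTo-∷ʳ k)) ⟩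
  sum (map f (upTo k ++ [ k ]))     ≡⟨ cong sum (map-++ f (upTo k) [ k ]) ⟩
  sum (map f (upTo k) ++ [ f k ])   ≡⟨ sum-++ (map f (upTo k)) [ f k ] ⟩
  sum (map f (upTo k)) + (f k + 0)  ≡⟨ cong (_+_ (sum (map f (upTo k)))) (+-identityʳ (f k)) ⟩
  sum (map f (upTo k)) + f k        ∎
  where open ≡-Reasoning

sum-map-+ : ∀ (f g : ℕ → ℕ) xs → sum (map (λ x → f x + g x) xs) ≡ sum (map f xs) + sum (map g xs)
sum-map-+ f g [] = refl
sum-map-+ f g (x ∷ xs) rewrite sum-map-+ f g xs =
  interchange (f x) (g x) (sum (map f xs)) (sum (map g xs))

_↦_ : ℕ → ℕ → ℕ → ℕ
(x ↦ v) c = if c ≡ᵇ x then v else 0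

sum-↦ : ∀ x v k → sum (map (x ↦ v) (upTo k)) ≡ (if x <ᵇ k then v else 0)
sum-↦ x v zero = refl
sum-↦ x v (suc k) rewrite sum-upTo-suc (x ↦ v) k | sum-↦ x v k with <-cmp x k
... | tri< x<k x≢k _ rewrite dec-true (x <? k) x<k | dec-true (x <? suc k) (m<n⇒m<1+n x<k)
                           | dec-false (k ≟ x) (x≢k ∘ sym) = +-identityʳ v
... | tri≈ _ refl _ rewrite dec-false (x <? x) (<-irrefl refl) | dec-true (x <? suc x) (n<1+n x)
                          | ≡ᵇ-refl x = refl
... | tri> x≮k x≢k k<x rewrite dec-false (x <? k) x≮k | dec-false (x <? suc k) (<⇒≱ k<x ∘ ≤-pred)
                           | dec-false (k ≟ x) (x≢k ∘ sym) = refl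

sum-↦-vanishing : ∀ x v k → (k ≤ x → v ≡ 0) → sum (map (x ↦ v) (upTo k)) ≡ v
sum-↦-vanishing x v k vanish rewrite sum-↦ x v k with x <? k
... | yes x<k rewrite dec-true (x <? k) x<k = refl
... | no x≮k rewrite dec-false (x <? k) x≮k = sym (vanish (≮⇒≥ x≮k))

m+n≡o⇒+m≡+o-+n : ∀ {m n o} → m + n ≡ o → + m ≡ + o -ℤ + n
m+n≡o⇒+m≡+o-+n {m} {n} refl = sym (begin
  + (m + n) -ℤ + n  ≡⟨ [+m]-[+n]≡m⊖n (m + n) n ⟩
  (m + n) ⊖ n       ≡⟨ ⊖-≥ (m≤n+m n m) ⟩
  + (m + n ∸ n)     ≡⟨ cong +_ (m+n∸n≡m m n) ⟩
  + m               ∎)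
  where open ≡-Reasoning

-- Connected sets of hexagons

Sorted : List ℕ → Set
Sorted = AllPairs _<_

smallGaps : List ℕ → Bool
smallGaps [] = true
smallGaps (x ∷ []) = true
smallGaps (x ∷ y ∷ S) = (y ≤ᵇ x + 2) ∧ smallGaps (y ∷ S)

adj-intro : x < y → y ≤ x + 2 → adj y x ≡ true
adj-intro {x} {y} x<y y≤x+2
  rewrite dec-false (y ≟ x) (λ y≡x → <-irrefl (sym y≡x) x<y) | m≤n⇒∣n-m∣≡n∸m (<⇒≤ x<y) =
  dec-true (y ∸ x ≤? 2) (subst (y ∸ x ≤_) (m+n∸m≡n x 2) (∸-monoˡ-≤ x y≤x+2))

adj⇒≤+2 : adj y x ≡ true → y ≤ x + 2
adj⇒≤+2 {y} {x} y~x with ≤-total y x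
... | inj₁ y≤x = ≤-trans y≤x (m≤m+n x 2)
... | inj₂ x≤y rewrite m≤n⇒∣n-m∣≡n∸m x≤y =
  subst (_≤ x + 2) (m+[n∸m]≡n x≤y) (+-monoʳ-≤ x (≤ᵇ-true⇒≤ (∧-conicalʳ _ _ y~x)))

iter-suc : ∀ r S R → iter (suc r) S R ≡ step S (iter r S R)
iter-suc zero S R = refl
iter-suc (suc r) S R = iter-suc r S (step S R)

Touches : ℕ → List ℕ → Set
Touches s R = ∃[ r ] r ∈ R × adj s r ≡ true

∈-step⁺ : ∀ {s} → s ∈ S → s ∈ R ⊎ Touches s R → s ∈ step S R
∈-step⁺ {R = R} {s} s∈S reached =
  ∈-filter⁺ (T? ∘ λ t → elem t R ∨ any (adj t) R) s∈S (≡true⇒T (reach reached))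
  where
  reach : s ∈ R ⊎ Touches s R → elem s R ∨ any (adj s) R ≡ true
  reach (inj₁ s∈R) rewrite ∈⇒elem s∈R = refl
  reach (inj₂ (r , r∈ , s~r)) rewrite any-∈⁺ (adj s) r∈ s~r = ∨-zeroʳ (elem s R)

∈-step⁻ : ∀ {s} → s ∈ step S R → s ∈ S × (s ∈ R ⊎ Touches s R)
∈-step⁻ {R = R} {s} s∈ with ∈-filter⁻ (T? ∘ λ t → elem t R ∨ any (adj t) R) s∈
... | s∈S , reach with ∨-true⁻ {elem s R} (T⇒≡true reach)
...   | inj₁ e = s∈S , inj₁ (elem⇒∈ R e)
...   | inj₂ e = s∈S , inj₂ (any-∈⁻ (adj s) R e)

∈-iter-+ : ∀ {s} R r t → s ∈ S → s ∈ iter r S R → s ∈ iter (r + t) S R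
∈-iter-+ R r zero _ s∈ rewrite +-identityʳ r = s∈
∈-iter-+ {S = S} R r (suc t) s∈S s∈ rewrite +-suc r t | iter-suc (r + t) S R =
  ∈-step⁺ {R = iter (r + t) S R} s∈S (inj₁ (∈-iter-+ R r t s∈S s∈))

smallGaps⇒∈-iter : ∀ R r {u} rest → (u ∷ rest) ⊆ S → Sorted (u ∷ rest) → smallGaps (u ∷ rest) ≡ true →
  u ∈ iter r S R → ∀ {e} → e ∈ u ∷ rest → e ∈ iter (r + length rest) S R
smallGaps⇒∈-iter R r rest sub _ _ u∈ (here refl) = ∈-iter-+ R r (length rest) (sub (here refl)) u∈
smallGaps⇒∈-iter {S = S} R r {u} (v ∷ rest) sub ((u<v ∷ _) ∷ sorted) gaps u∈ {e} (there e∈) =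
  subst (λ i → e ∈ iter i S R) (sym (+-suc r (length rest)))
    (smallGaps⇒∈-iter R (suc r) rest (sub ∘ there) sorted (∧-conicalʳ _ _ gaps) v∈ e∈)
  where
  v~u : adj v u ≡ true
  v~u = adj-intro u<v (≤ᵇ-true⇒≤ (∧-conicalˡ _ _ gaps))
  v∈ : v ∈ iter (suc r) S R
  v∈ rewrite iter-suc r S R = ∈-step⁺ {R = iter r S R} (sub (there (here refl))) (inj₂ (u , u∈ , v~u))

connected-true : Sorted S → S ≢ [] → smallGaps S ≡ true → connected S ≡ true
connected-true {[]} _ S≢[] _ = ⊥-elim (S≢[] refl)
connected-true {x ∷ T} sorted _ gaps =
  all-∈⁺ _ (x ∷ T) λ e∈ → ∈⇒elem (smallGaps⇒∈-iter [ x ] 1 T id sorted gaps x∈ e∈)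
  where
  x∈ : x ∈ iter 1 (x ∷ T) [ x ]
  x∈ = ∈-step⁺ {R = [ x ]} (here refl) (inj₁ (here refl))

record Gap (x : ℕ) (S : List ℕ) : Set where
  field
    low high : ℕ
    x≤low : x ≤ low
    wide : low + 2 < high
    high∈ : high ∈ S
    split : ∀ {s} → s ∈ S → s ≤ low ⊎ high ≤ s

gap : ∀ x T → Sorted (x ∷ T) → smallGaps (x ∷ T) ≡ false → Gap x (x ∷ T)
gap x (y ∷ T) ((x<y ∷ _) ∷ sorted@(y<T ∷ _)) gaps with y ≤ᵇ x + 2 in y≤?
... | false = record
  { low = x ; high = y ; x≤low = ≤-refl ; wide = ≤ᵇ-false⇒> y≤?
  ; high∈ = there (here refl) ; split = split }
  where
  split : ∀ {s} → s ∈ x ∷ y ∷ T → s ≤ x ⊎ y ≤ s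
  split (here refl) = inj₁ ≤-refl
  split (there (here refl)) = inj₂ ≤-refl
  split (there (there s∈)) = inj₂ (<⇒≤ (All.lookup y<T s∈))
... | true = record
  { low = low ; high = high ; x≤low = x≤low′ ; wide = wide ; high∈ = there high∈ ; split = split′ }
  where
  open Gap (gap y T sorted gaps)
  x≤low′ : x ≤ low
  x≤low′ = ≤-trans (<⇒≤ x<y) x≤low
  split′ : ∀ {s} → s ∈ x ∷ y ∷ T → s ≤ low ⊎ high ≤ s
  split′ (here refl) = inj₁ x≤low′
  split′ (there s∈) = split s∈

iter-below-gap : ∀ {low high} → low + 2 < high → (∀ {s} → s ∈ S → s ≤ low ⊎ high ≤ s) →
  (∀ {s} → s ∈ R → s ≤ low) → ∀ r {s} → s ∈ iter r S R → s ≤ low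
iter-below-gap wide split base zero s∈ = base s∈
iter-below-gap {S = S} {R = R} {low} wide split base (suc r) s∈ rewrite iter-suc r S R with ∈-step⁻ s∈
... | _ , inj₁ s∈R = iter-below-gap wide split base r s∈R
... | s∈S , inj₂ (t , t∈ , s~t) with split s∈S
...   | inj₁ s≤low = s≤low
...   | inj₂ high≤s = ⊥-elim (<⇒≱ wide (≤-trans high≤s (≤-trans (adj⇒≤+2 s~t) t+2≤low+2)))
  where
  t+2≤low+2 : t + 2 ≤ low + 2
  t+2≤low+2 = +-monoˡ-≤ 2 (iter-below-gap wide split base r t∈)

connected-false : Sorted S → smallGaps S ≡ false → connected S ≡ false
connected-false {x ∷ T} sorted gaps = all-∈-false _ high∈ (∉⇒elem-false high∉)
  where
  open Gap (gap x T sorted gaps)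
  base : ∀ {s} → s ∈ [ x ] → s ≤ low
  base (here refl) = x≤low
  high∉ : ¬ high ∈ iter (length (x ∷ T)) (x ∷ T) [ x ]
  high∉ high∈R =
    <⇒≱ wide (≤-trans (iter-below-gap wide split base (length (x ∷ T)) high∈R) (m≤m+n low 2))

canAppend : List ℕ → ℕ → Bool
canAppend [] z = true
canAppend (y ∷ []) z = z ≤ᵇ y + 2
canAppend (_ ∷ y ∷ S) z = canAppend (y ∷ S) z

smallGaps-∷ʳ : ∀ S y → smallGaps (S ∷ʳ y) ≡ smallGaps S ∧ canAppend S y
smallGaps-∷ʳ [] y = refl
smallGaps-∷ʳ (x ∷ []) y = ∧-identityʳ (y ≤ᵇ x + 2)
smallGaps-∷ʳ (x ∷ x′ ∷ S) y rewrite smallGaps-∷ʳ (x′ ∷ S) y =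
  sym (∧-assoc (x′ ≤ᵇ x + 2) (smallGaps (x′ ∷ S)) (canAppend (x′ ∷ S) y))

canAppend-∷ʳ : ∀ S y z → canAppend (S ∷ʳ y) z ≡ (z ≤ᵇ y + 2)
canAppend-∷ʳ [] y z = refl
canAppend-∷ʳ (_ ∷ []) y z = refl
canAppend-∷ʳ (_ ∷ x ∷ S) y z = canAppend-∷ʳ (x ∷ S) y z

canAppend-far : ∀ S z → S ≢ [] → All (λ y → y + 2 < z) S → canAppend S z ≡ false
canAppend-far [] z S≢[] _ = ⊥-elim (S≢[] refl)
canAppend-far (y ∷ []) z _ (y+2<z ∷ []) = dec-false (z ≤? y + 2) (<⇒≱ y+2<z)
canAppend-far (_ ∷ y ∷ S) z _ (_ ∷ far) = canAppend-far (y ∷ S) z (λ ()) far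

-- Blocks and canonical codes

block-∷ʳ : ∀ w a c → block (w ∷ʳ a) c ≡ block w c ++ (if a ≡ᵇ c then [ length w ] else [])
block-∷ʳ w a c = begin
  block (w ∷ʳ a) c
    ≡⟨ cong (map proj₁ ∘ filterᵇ labelled) indexed ⟩
  map proj₁ (filterᵇ labelled (zip (upTo len) w ++ [ (len , a) ]))
    ≡⟨ cong (map proj₁) (filter-++ (T? ∘ labelled) (zip (upTo len) w) _) ⟩
  map proj₁ (filterᵇ labelled (zip (upTo len) w) ++ filterᵇ labelled [ (len , a) ])
    ≡⟨ map-++ proj₁ (filterᵇ labelled (zip (upTo len) w)) _ ⟩
  block w c ++ map proj₁ (filterᵇ labelled [ (len , a) ])
    ≡⟨ cong (block w c ++_) lastEntry ⟩
  block w c ++ (if a ≡ᵇ c then [ len ] else []) ∎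
  where
  open ≡-Reasoning
  len : ℕ
  len = length w
  labelled : ℕ × ℕ → Bool
  labelled p = proj₂ p ≡ᵇ c
  indexed : zip (upTo (length (w ∷ʳ a))) (w ∷ʳ a) ≡ zip (upTo len) w ∷ʳ (len , a)
  indexed rewrite length-∷ʳ w a | sym (upTo-∷ʳ len) = zip-∷ʳ (upTo len) w len a (length-upTo len)
  lastEntry : map proj₁ (filterᵇ labelled [ (len , a) ]) ≡ (if a ≡ᵇ c then [ len ] else [])
  lastEntry with a ≡ᵇ c
  ... | true = refl
  ... | false = refl

block-∷ʳ-≡ : ∀ w a → block (w ∷ʳ a) a ≡ block w a ∷ʳ length w
block-∷ʳ-≡ w a rewrite block-∷ʳ w a a | ≡ᵇ-refl a = refl

block-∷ʳ-≢ : ∀ w {a c} → a ≢ c → block (w ∷ʳ a) c ≡ block w c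
block-∷ʳ-≢ w {a} {c} a≢c rewrite block-∷ʳ w a c | dec-false (a ≟ c) a≢c = ++-identityʳ (block w c)

block-bounded : ∀ w c → All (_< length w) (block w c)
block-bounded w c = go (reverseView w)
  where
  go : ∀ {w} → Reverse w → All (_< length w) (block w c)
  go [] = []
  go (w ∶ rw ∶ʳ a) rewrite block-∷ʳ w a c | length-∷ʳ w a =
    All.++⁺ (All.map m<n⇒m<1+n (go rw)) (lastEntry (a ≡ᵇ c))
    where
    lastEntry : ∀ b → All (_< suc (length w)) (if b then [ length w ] else [])
    lastEntry true = ≤-refl ∷ []
    lastEntry false = []

block-sorted : ∀ w c → Sorted (block w c)
block-sorted w c = go (reverseView w)
  where
  go : ∀ {w} → Reverse w → Sorted (block w c)
  go [] = []
  go (w ∶ rw ∶ʳ a) with a ≟ c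
  ... | yes refl rewrite block-∷ʳ-≡ w a =
    AllPairs.++⁺ (go rw) (All.[] ∷ []) (All.map (_∷ All.[]) (block-bounded w a))
  ... | no a≢c rewrite block-∷ʳ-≢ w a≢c = go rw

block-beyond : ∀ {k} w c → All (_< k) w → k ≤ c → block w c ≡ []
block-beyond {k} w c = go (reverseView w)
  where
  go : ∀ {w} → Reverse w → All (_< k) w → k ≤ c → block w c ≡ []
  go [] _ _ = refl
  go (w ∶ rw ∶ʳ a) w<k k≤c with All.∷ʳ⁻ w<k
  ... | w′<k , a<k rewrite block-∷ʳ-≢ w (λ a≡c → <⇒≱ a<k (subst (k ≤_) (sym a≡c) k≤c)) =
    go rw w′<k k≤c

nextLabel : ℕ → List ℕ → ℕ
nextLabel m [] = m
nextLabel m (c ∷ w) = if c ≡ᵇ m then nextLabel (suc m) w else nextLabel m w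

canonicalFrom-++ : ∀ m w v →
  canonicalFrom m (w ++ v) ≡ canonicalFrom m w ∧ canonicalFrom (nextLabel m w) v
canonicalFrom-++ m [] v = refl
canonicalFrom-++ m (c ∷ w) v with c ≡ᵇ m
... | true = canonicalFrom-++ (suc m) w v
... | false rewrite canonicalFrom-++ m w v = sym (∧-assoc (c <ᵇ m) (canonicalFrom m w) _)

nextLabel-++ : ∀ m w v → nextLabel m (w ++ v) ≡ nextLabel (nextLabel m w) v
nextLabel-++ m [] v = refl
nextLabel-++ m (c ∷ w) v with c ≡ᵇ m
... | true = nextLabel-++ (suc m) w v
... | false = nextLabel-++ m w v

-- Recognising divisions by an automaton

record State : Set where
  constructor ⟨_,_,_⟩
  field
    opened : ℕ
    last beforeLast : Maybe ℕ

matches : Maybe ℕ → ℕ → Bool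
matches nothing c = false
matches (just x) c = c ≡ᵇ x

recent : State → ℕ → Bool
recent ⟨ _ , p , q ⟩ c = matches p c ∨ matches q c

δ : State → ℕ → Maybe State
δ s@(⟨ m , p , _ ⟩) c =
  if c ≡ᵇ m then just ⟨ suc m , just c , p ⟩
  else if recent s c then just ⟨ m , just c , p ⟩
  else nothing

feed : Maybe State → ℕ → Maybe State
feed nothing c = nothing
feed (just s) c = δ s c

run : Maybe State → List ℕ → Maybe State
run = foldl feed

initial : Maybe State
initial = just ⟨ 0 , nothing , nothing ⟩

accepting : ℕ → Maybe State → Bool
accepting k nothing = false
accepting k (just ⟨ m , _ , _ ⟩) = m ≡ᵇ k

-- last and beforeLast are tracked through the blocks: c is the last letter of w exactly when
-- its block comes within 2 of position length w + 1, and one of the last two exactly when it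
-- comes within 2 of position length w.
record Invariant (w : List ℕ) (s : State) : Set where
  open State s
  field
    canonical : canonicalFrom 0 w ≡ true
    gapsSmall : ∀ c → smallGaps (block w c) ≡ true
    nextLabel≡ : nextLabel 0 w ≡ opened
    used : ∀ {c} → c < opened → block w c ≢ []
    unused : ∀ {c} → opened ≤ c → block w c ≡ []
    last-spec : ∀ {c} → c < opened → matches last c ≡ canAppend (block w c) (suc (length w))
    recent-spec : ∀ {c} → c < opened → recent s c ≡ canAppend (block w c) (length w)
    recent-opened : ∀ {c} → recent s c ≡ true → c < opened

invariant-∷ʳ : ∀ {w m p q m′} a → Invariant w ⟨ m , p , q ⟩ →
  m ≤ m′ → a < m′ → (∀ {c} → c < m′ → c ≢ a → c < m) →
  canonicalFrom m [ a ] ≡ true → nextLabel m [ a ] ≡ m′ → canAppend (block w a) (length w) ≡ true →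
  Invariant (w ∷ʳ a) ⟨ m′ , just a , p ⟩
invariant-∷ʳ {w} {m} {p} {q} {m′} a I m≤m′ a<m′ old step-canonical step-label appendable = record
  { canonical = canonical′ ; gapsSmall = gapsSmall′ ; nextLabel≡ = nextLabel≡′
  ; used = used′ ; unused = unused′ ; last-spec = last-spec′ ; recent-spec = recent-spec′
  ; recent-opened = recent-opened′ }
  where
  open Invariant I
  len : ℕ
  len = length w
  canonical′ : canonicalFrom 0 (w ∷ʳ a) ≡ true
  canonical′ rewrite canonicalFrom-++ 0 w [ a ] | canonical | nextLabel≡ = step-canonical
  nextLabel≡′ : nextLabel 0 (w ∷ʳ a) ≡ m′
  nextLabel≡′ rewrite nextLabel-++ 0 w [ a ] | nextLabel≡ = step-label
  gapsSmall′ : ∀ c → smallGaps (block (w ∷ʳ a) c) ≡ true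
  gapsSmall′ c with c ≟ a
  ... | yes c≡a rewrite c≡a | block-∷ʳ-≡ w a | smallGaps-∷ʳ (block w a) len | gapsSmall a = appendable
  ... | no c≢a rewrite block-∷ʳ-≢ w (c≢a ∘ sym) = gapsSmall c
  used′ : ∀ {c} → c < m′ → block (w ∷ʳ a) c ≢ []
  used′ {c} c<m′ with c ≟ a
  ... | yes c≡a rewrite c≡a | block-∷ʳ-≡ w a = ∷ʳ≢[] (block w a) len
  ... | no c≢a rewrite block-∷ʳ-≢ w (c≢a ∘ sym) = used (old c<m′ c≢a)
  unused′ : ∀ {c} → m′ ≤ c → block (w ∷ʳ a) c ≡ []
  unused′ m′≤c rewrite block-∷ʳ-≢ w (λ a≡c → <⇒≱ a<m′ (subst (m′ ≤_) (sym a≡c) m′≤c)) =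
    unused (≤-trans m≤m′ m′≤c)
  suc≤+2 : suc len ≤ len + 2
  suc≤+2 = ≤-trans (n≤1+n (suc len)) (≤-reflexive (+-comm 2 len))
  last-spec′ : ∀ {c} → c < m′ →
    matches (just a) c ≡ canAppend (block (w ∷ʳ a) c) (suc (length (w ∷ʳ a)))
  last-spec′ {c} c<m′ with c ≟ a
  ... | yes c≡a rewrite c≡a | block-∷ʳ-≡ w a | length-∷ʳ w a | canAppend-∷ʳ (block w a) len (2 + len)
                        | ≡ᵇ-refl a =
    sym (dec-true (2 + len ≤? len + 2) (≤-reflexive (+-comm 2 len)))
  ... | no c≢a rewrite block-∷ʳ-≢ w (c≢a ∘ sym) | length-∷ʳ w a | dec-false (c ≟ a) c≢a =
    sym (canAppend-far (block w c) (2 + len) (used (old c<m′ c≢a))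
      (All.map (λ {y} y<len → subst (_< 2 + len) (+-comm 2 y) (s≤s (s≤s y<len))) (block-bounded w c)))
  recent-spec′ : ∀ {c} → c < m′ →
    recent ⟨ m′ , just a , p ⟩ c ≡ canAppend (block (w ∷ʳ a) c) (length (w ∷ʳ a))
  recent-spec′ {c} c<m′ with c ≟ a
  ... | yes c≡a rewrite c≡a | block-∷ʳ-≡ w a | length-∷ʳ w a | canAppend-∷ʳ (block w a) len (suc len)
                        | ≡ᵇ-refl a =
    sym (dec-true (suc len ≤? len + 2) suc≤+2)
  ... | no c≢a rewrite block-∷ʳ-≢ w (c≢a ∘ sym) | length-∷ʳ w a | dec-false (c ≟ a) c≢a =
    last-spec (old c<m′ c≢a)
  recent-opened′ : ∀ {c} → recent ⟨ m′ , just a , p ⟩ c ≡ true → c < m′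
  recent-opened′ {c} rec with c ≡ᵇ a in c≡ᵇa
  ... | true = subst (_< m′) (sym (≡ᵇ-true⇒≡ c≡ᵇa)) a<m′
  ... | false = <-≤-trans (recent-opened {c} (trans (cong (_∨ matches q c) rec) refl)) m≤m′

invariant-[] : Invariant [] ⟨ 0 , nothing , nothing ⟩
invariant-[] = record
  { canonical = refl ; gapsSmall = λ _ → refl ; nextLabel≡ = refl ; used = λ () ; unused = λ _ → refl
  ; last-spec = λ () ; recent-spec = λ () ; recent-opened = λ () }

invariant-open : ∀ {w m p q} → Invariant w ⟨ m , p , q ⟩ → Invariant (w ∷ʳ m) ⟨ suc m , just m , p ⟩
invariant-open {w} {m} I = invariant-∷ʳ m I (n≤1+n m) (n<1+n m) old step-canonical step-label appendable
  where
  old : ∀ {c} → c < suc m → c ≢ m → c < m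
  old c<1+m c≢m = ≤∧≢⇒< (≤-pred c<1+m) c≢m
  step-canonical : canonicalFrom m [ m ] ≡ true
  step-canonical rewrite ≡ᵇ-refl m = refl
  step-label : nextLabel m [ m ] ≡ suc m
  step-label rewrite ≡ᵇ-refl m = refl
  appendable : canAppend (block w m) (length w) ≡ true
  appendable rewrite Invariant.unused I (≤-refl {m}) = refl

invariant-repeat : ∀ {w m p q a} → Invariant w ⟨ m , p , q ⟩ → recent ⟨ m , p , q ⟩ a ≡ true →
  Invariant (w ∷ʳ a) ⟨ m , just a , p ⟩
invariant-repeat {w} {m} {a = a} I rec =
  invariant-∷ʳ a I ≤-refl a<m (λ c<m _ → c<m) step-canonical step-label appendable
  where
  open Invariant I
  a<m : a < m
  a<m = recent-opened rec
  step-canonical : canonicalFrom m [ a ] ≡ true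
  step-canonical rewrite dec-false (a ≟ m) (<⇒≢ a<m) | dec-true (a <? m) a<m = refl
  step-label : nextLabel m [ a ] ≡ m
  step-label rewrite dec-false (a ≟ m) (<⇒≢ a<m) = refl
  appendable : canAppend (block w a) (length w) ≡ true
  appendable = trans (sym (recent-spec a<m)) rec

Invalid : ℕ → List ℕ → Set
Invalid k w = canonicalFrom 0 w ≡ false ⊎ ∃[ c ] c < k × smallGaps (block w c) ≡ false

Tracks : ℕ → List ℕ → Maybe State → Set
Tracks k w nothing = Invalid k w
Tracks k w (just s) = Invariant w s

invalid-∷ʳ : ∀ {k} w a → Invalid k w → Invalid k (w ∷ʳ a)
invalid-∷ʳ w a (inj₁ noncanonical) =
  inj₁ (trans (canonicalFrom-++ 0 w [ a ]) (cong (_∧ canonicalFrom (nextLabel 0 w) [ a ]) noncanonical))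
invalid-∷ʳ w a (inj₂ (c , c<k , gappy)) = inj₂ (c , c<k , gappy′)
  where
  gappy′ : smallGaps (block (w ∷ʳ a) c) ≡ false
  gappy′ with a ≟ c
  ... | yes a≡c rewrite sym a≡c | block-∷ʳ-≡ w a | smallGaps-∷ʳ (block w a) (length w) | gappy =
    refl
  ... | no a≢c rewrite block-∷ʳ-≢ w a≢c = gappy

smallGaps-∷ʳ-stale : ∀ {w m p q a} → Invariant w ⟨ m , p , q ⟩ → a < m →
  recent ⟨ m , p , q ⟩ a ≡ false → smallGaps (block (w ∷ʳ a) a) ≡ false
smallGaps-∷ʳ-stale {w = w} {a = a} I a<m stale
  rewrite block-∷ʳ-≡ w a | smallGaps-∷ʳ (block w a) (length w) | Invariant.gapsSmall I a
        | sym (Invariant.recent-spec I a<m) = stale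

canonicalFrom-∷ʳ-skip : ∀ {w m p q a} → Invariant w ⟨ m , p , q ⟩ → a ≢ m → ¬ a < m →
  canonicalFrom 0 (w ∷ʳ a) ≡ false
canonicalFrom-∷ʳ-skip {w} {m} {a = a} I a≢m a≮m
  rewrite canonicalFrom-++ 0 w [ a ] | Invariant.canonical I | Invariant.nextLabel≡ I
        | dec-false (a ≟ m) a≢m | dec-false (a <? m) a≮m = refl

tracks-∷ʳ : ∀ {k} w a ms → a < k → Tracks k w ms → Tracks k (w ∷ʳ a) (feed ms a)
tracks-∷ʳ w a nothing _ invalid = invalid-∷ʳ w a invalid
tracks-∷ʳ w a (just s@(⟨ m , p , q ⟩)) a<k I with a ≟ m
... | yes refl rewrite ≡ᵇ-refl a = invariant-open I
... | no a≢m rewrite dec-false (a ≟ m) a≢m with recent s a in rec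
...   | true = invariant-repeat I rec
...   | false with a <? m
...     | yes a<m = inj₂ (a , a<k , smallGaps-∷ʳ-stale I a<m rec)
...     | no a≮m = inj₁ (canonicalFrom-∷ʳ-skip I a≢m a≮m)

tracks : ∀ {k} w → All (_< k) w → Tracks k w (run initial w)
tracks {k} w = go (reverseView w)
  where
  go : ∀ {w} → Reverse w → All (_< k) w → Tracks k w (run initial w)
  go [] _ = invariant-[]
  go (w ∶ rw ∶ʳ a) w<k with All.∷ʳ⁻ w<k
  ... | w′<k , a<k rewrite foldl-∷ʳ feed initial a w =
    tracks-∷ʳ w a (run initial w) a<k (go rw w′<k)

all-connected : ∀ {k w m p q} → Invariant w ⟨ m , p , q ⟩ → All (_< k) w →
  all (λ c → connected (block w c)) (upTo k) ≡ (m ≡ᵇ k)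
all-connected {k} {w} {m} I w<k with <-cmp m k
... | tri< m<k m≢k _ rewrite dec-false (m ≟ k) m≢k =
  all-∈-false _ (∈-upTo⁺ m<k) (cong connected (unused ≤-refl))
  where open Invariant I
... | tri≈ _ refl _ rewrite ≡ᵇ-refl m =
  all-∈⁺ _ (upTo m) λ c∈ → connected-true (block-sorted w _) (used (∈-upTo⁻ c∈)) (gapsSmall _)
  where open Invariant I
... | tri> _ _ k<m = ⊥-elim (Invariant.used I k<m (block-beyond w k w<k ≤-refl))

validDivision≡accepting : ∀ {k} w → All (_< k) w → validDivision k w ≡ accepting k (run initial w)
validDivision≡accepting {k} w w<k with run initial w | tracks w w<k
... | nothing | inj₁ noncanonical rewrite noncanonical = refl
... | nothing | inj₂ (c , c<k , gappy)
  rewrite all-∈-false (λ c → connected (block w c)) (∈-upTo⁺ c<k)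
            (connected-false (block-sorted w c) gappy) =
  ∧-zeroʳ (canonicalFrom 0 w)
... | just ⟨ m , p , q ⟩ | I rewrite Invariant.canonical I = all-connected I w<k

-- Counting accepted codes

words-bounded : ∀ k n → All (All (_< k)) (words k n)
words-bounded k zero = [] ∷ []
words-bounded k (suc n) =
  All.concat⁺ (All.map⁺ (All.map extend (All.all-upTo k)))
  where
  extend : ∀ {c} → c < k → All (All (_< k)) (map (c ∷_) (words k n))
  extend c<k = All.map⁺ (All.map (c<k ∷_) (words-bounded k n))

accepted : ℕ → Maybe State → ℕ → ℕ
accepted k ms n = length (filterᵇ (accepting k ∘ run ms) (words k n))

count≡accepted : ∀ k n → count k n ≡ accepted k initial n
count≡accepted k n =
  cong length (filterᵇ-cong-All (All.map (validDivision≡accepting _) (words-bounded k n)))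

run-nothing : ∀ w → run nothing w ≡ nothing
run-nothing [] = refl
run-nothing (_ ∷ w) = run-nothing w

accepted-nothing : ∀ k n → accepted k nothing n ≡ 0
accepted-nothing k n = cong length (filterᵇ-none (cong (accepting k) ∘ run-nothing) (words k n))

accepted-zero : ∀ k m p q → accepted k (just ⟨ m , p , q ⟩) zero ≡ (if m ≡ᵇ k then 1 else 0)
accepted-zero k m p q with m ≡ᵇ k
... | true = refl
... | false = refl

accepted-suc : ∀ k s n → accepted k (just s) (suc n) ≡ sum (map (λ c → accepted k (δ s c) n) (upTo k))
accepted-suc k s n = trans
  (length-filterᵇ-concatMap (accepting k ∘ run (just s)) (λ c → map (c ∷_) (words k n)) (upTo k))
  (cong sum (map-cong first-letter (upTo k)))
  where
  first-letter : ∀ c → length (filterᵇ (accepting k ∘ run (just s)) (map (c ∷_) (words k n))) ≡ accepted k (δ s c) n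
  first-letter c = length-filterᵇ-map (accepting k ∘ run (just s)) (c ∷_) (words k n)

-- ways₁ k m n: the number of ways to append n letters to a code with m blocks opened whose last
-- two letters agree (or which has a single letter) so that exactly k blocks are used in the end;
-- ways₂ k m n: the same when the last two letters differ.
ways₁ : ℕ → ℕ → ℕ → ℕ
ways₂ : ℕ → ℕ → ℕ → ℕ
ways₁ k m zero = if m ≡ᵇ k then 1 else 0
ways₁ k m (suc n) = ways₁ k m n + ways₂ k (suc m) n
ways₂ k m zero = if m ≡ᵇ k then 1 else 0
ways₂ k m (suc n) = ways₁ k m n + ways₂ k m n + ways₂ k (suc m) n

ways-vanish : ∀ {k m} n → k < m → ways₁ k m n ≡ 0 × ways₂ k m n ≡ 0
ways-vanish {k} {m} zero k<m rewrite dec-false (m ≟ k) (>⇒≢ k<m) = refl , refl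
ways-vanish (suc n) k<m
  with ways-vanish n k<m | ways-vanish n (m<n⇒m<1+n k<m)
... | e , f | _ , f′ rewrite e | f | f′ = refl , refl

ways-shift : ∀ k m n →
  ways₁ (suc k) (suc m) n ≡ ways₁ k m n × ways₂ (suc k) (suc m) n ≡ ways₂ k m n
ways-shift k m zero = refl , refl
ways-shift k m (suc n) with ways-shift k m n | ways-shift k (suc m) n
... | e , f | _ , f′ rewrite e | f | f′ = refl , refl

sum-↦-ways₁ : ∀ {k m a} n → a < m → sum (map (a ↦ ways₁ k m n) (upTo k)) ≡ ways₁ k m n
sum-↦-ways₁ n a<m = sum-↦-vanishing _ _ _ (λ k≤a → proj₁ (ways-vanish n (≤-<-trans k≤a a<m)))

sum-↦-ways₂ : ∀ {k m a} n → a < m → sum (map (a ↦ ways₂ k m n) (upTo k)) ≡ ways₂ k m n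
sum-↦-ways₂ n a<m = sum-↦-vanishing _ _ _ (λ k≤a → proj₂ (ways-vanish n (≤-<-trans k≤a a<m)))

SingleRecent : ℕ → Maybe ℕ → Set
SingleRecent a q = q ≡ nothing ⊎ q ≡ just a

recent-single : ∀ {m a q} → SingleRecent a q → ∀ c → recent ⟨ m , just a , q ⟩ c ≡ (c ≡ᵇ a)
recent-single (inj₁ refl) c = ∨-identityʳ _
recent-single (inj₂ refl) c = ∨-idem _

accepted-single : ∀ k n {m a q} → a < m → SingleRecent a q →
  accepted k (just ⟨ m , just a , q ⟩) n ≡ ways₁ k m n
accepted-double : ∀ k n {m a b} → a < m → b < m → a ≢ b →
  accepted k (just ⟨ m , just a , just b ⟩) n ≡ ways₂ k m n
accepted-δ-single : ∀ k n {m a q} → a < m → SingleRecent a q → ∀ c →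
  accepted k (δ ⟨ m , just a , q ⟩ c) n ≡ (a ↦ ways₁ k m n) c + (m ↦ ways₂ k (suc m) n) c
accepted-δ-double : ∀ k n {m a b} → a < m → b < m → a ≢ b → ∀ c →
  accepted k (δ ⟨ m , just a , just b ⟩ c) n ≡
    (a ↦ ways₁ k m n) c + (b ↦ ways₂ k m n) c + (m ↦ ways₂ k (suc m) n) c

accepted-single k zero {m} _ _ = accepted-zero k m _ _
accepted-single k (suc n) {m} {a} {q} a<m single = begin
  accepted k (just ⟨ m , just a , q ⟩) (suc n)
    ≡⟨ accepted-suc k _ n ⟩
  ∑ (λ c → accepted k (δ ⟨ m , just a , q ⟩ c) n)
    ≡⟨ cong sum (map-cong (accepted-δ-single k n a<m single) (upTo k)) ⟩
  ∑ (λ c → (a ↦ ways₁ k m n) c + (m ↦ ways₂ k (suc m) n) c)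
    ≡⟨ sum-map-+ (a ↦ ways₁ k m n) (m ↦ ways₂ k (suc m) n) (upTo k) ⟩
  ∑ (a ↦ ways₁ k m n) + ∑ (m ↦ ways₂ k (suc m) n)
    ≡⟨ cong₂ _+_ (sum-↦-ways₁ n a<m) (sum-↦-ways₂ n (n<1+n m)) ⟩
  ways₁ k m n + ways₂ k (suc m) n ∎
  where
  open ≡-Reasoning
  ∑ : (ℕ → ℕ) → ℕ
  ∑ f = sum (map f (upTo k))

accepted-double k zero {m} _ _ _ = accepted-zero k m _ _
accepted-double k (suc n) {m} {a} {b} a<m b<m a≢b = begin
  accepted k (just ⟨ m , just a , just b ⟩) (suc n)
    ≡⟨ accepted-suc k _ n ⟩
  ∑ (λ c → accepted k (δ ⟨ m , just a , just b ⟩ c) n)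
    ≡⟨ cong sum (map-cong (accepted-δ-double k n a<m b<m a≢b) (upTo k)) ⟩
  ∑ (λ c → (a ↦ ways₁ k m n) c + (b ↦ ways₂ k m n) c + (m ↦ ways₂ k (suc m) n) c)
    ≡⟨ sum-map-+ (λ c → (a ↦ ways₁ k m n) c + (b ↦ ways₂ k m n) c) (m ↦ ways₂ k (suc m) n) (upTo k) ⟩
  ∑ (λ c → (a ↦ ways₁ k m n) c + (b ↦ ways₂ k m n) c) + ∑ (m ↦ ways₂ k (suc m) n)
    ≡⟨ cong (_+ ∑ (m ↦ ways₂ k (suc m) n)) (sum-map-+ (a ↦ ways₁ k m n) (b ↦ ways₂ k m n) (upTo k)) ⟩
  ∑ (a ↦ ways₁ k m n) + ∑ (b ↦ ways₂ k m n) + ∑ (m ↦ ways₂ k (suc m) n)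
    ≡⟨ cong₂ _+_ (cong₂ _+_ (sum-↦-ways₁ n a<m) (sum-↦-ways₂ n b<m)) (sum-↦-ways₂ n (n<1+n m)) ⟩
  ways₁ k m n + ways₂ k m n + ways₂ k (suc m) n ∎
  where
  open ≡-Reasoning
  ∑ : (ℕ → ℕ) → ℕ
  ∑ f = sum (map f (upTo k))

accepted-δ-single k n {m} {a} a<m single c with c ≟ m
... | yes c≡m rewrite c≡m | ≡ᵇ-refl m | dec-false (m ≟ a) (>⇒≢ a<m) =
  accepted-double k n (n<1+n m) (m<n⇒m<1+n a<m) (>⇒≢ a<m)
... | no c≢m rewrite dec-false (c ≟ m) c≢m | recent-single {m} single c with c ≟ a
...   | yes c≡a rewrite c≡a | ≡ᵇ-refl a =
  trans (accepted-single k n a<m (inj₂ refl)) (sym (+-identityʳ _))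
...   | no c≢a rewrite dec-false (c ≟ a) c≢a = accepted-nothing k n

accepted-δ-double k n {m} {a} {b} a<m b<m a≢b c with c ≟ m
... | yes c≡m rewrite c≡m | ≡ᵇ-refl m | dec-false (m ≟ a) (>⇒≢ a<m) | dec-false (m ≟ b) (>⇒≢ b<m) =
  accepted-double k n (n<1+n m) (m<n⇒m<1+n a<m) (>⇒≢ a<m)
... | no c≢m rewrite dec-false (c ≟ m) c≢m with c ≟ a
...   | yes c≡a rewrite c≡a | ≡ᵇ-refl a | dec-false (a ≟ b) a≢b =
  trans (accepted-single k n a<m (inj₂ refl)) (sym (trans (+-identityʳ _) (+-identityʳ _)))
...   | no c≢a rewrite dec-false (c ≟ a) c≢a with c ≟ b
...     | yes c≡b rewrite c≡b | ≡ᵇ-refl b =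
  trans (accepted-double k n b<m a<m (a≢b ∘ sym)) (sym (+-identityʳ _))
...     | no c≢b rewrite dec-false (c ≟ b) c≢b = accepted-nothing k n

accepted-initial : ∀ k n → accepted k initial (suc n) ≡ ways₁ k 1 n
accepted-initial k n = begin
  accepted k initial (suc n)
    ≡⟨ accepted-suc k _ n ⟩
  sum (map (λ c → accepted k (δ ⟨ 0 , nothing , nothing ⟩ c) n) (upTo k))
    ≡⟨ cong sum (map-cong first (upTo k)) ⟩
  sum (map (0 ↦ ways₁ k 1 n) (upTo k))
    ≡⟨ sum-↦-ways₁ n (n<1+n 0) ⟩
  ways₁ k 1 n ∎
  where
  open ≡-Reasoning
  first : ∀ c → accepted k (δ ⟨ 0 , nothing , nothing ⟩ c) n ≡ (0 ↦ ways₁ k 1 n) c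
  first zero = accepted-single k n (s≤s z≤n) (inj₁ refl)
  first (suc c) = accepted-nothing k n

-- The recurrence

-- d_k(0) = d_k(1) = [k = 1], so the shift n ∸ 1 is also right at n = 0.
d≡ways₁ : ∀ k n → d (+ k) n ≡ + ways₁ k 1 (n ∸ 1)
d≡ways₁ zero zero = refl
d≡ways₁ (suc zero) zero = refl
d≡ways₁ (suc (suc k)) zero = refl
d≡ways₁ k (suc n) = cong +_ (trans (count≡accepted k (suc n)) (accepted-initial k n))

d-previous≡ways₁ : ∀ k n → d (+ k -ℤ + 1) (suc n) ≡ + ways₁ k 2 n
d-previous≡ways₁ zero n = cong +_ (sym (proj₁ (ways-vanish n (s≤s z≤n))))
d-previous≡ways₁ (suc k) n = trans (d≡ways₁ k (suc n)) (cong +_ (sym (proj₁ (ways-shift k 1 n))))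

ways₁-recurrence : ∀ k m n →
  ways₁ k m (2 + n) + ways₁ k m n ≡ ways₁ k (suc m) (suc n) + 2 * ways₁ k m (suc n)
ways₁-recurrence k m n =
  identity (ways₁ k m n) (ways₂ k (suc m) n) (ways₁ k (suc m) n) (ways₂ k (2 + m) n)
  where
  open +-*-Solver using (solve; _:=_; _:+_; _:*_; con)
  identity : ∀ a b c e → a + b + (c + b + e) + a ≡ c + e + 2 * (a + b)
  identity = solve 4 (λ a b c e → a :+ b :+ (c :+ b :+ e) :+ a := c :+ e :+ con 2 :* (a :+ b)) refl

ways₁-recurrence-at-1 : ∀ k n →
  ways₁ k 1 (suc n) + ways₁ k 1 (n ∸ 1) ≡ ways₁ k 2 n + 2 * ways₁ k 1 n
ways₁-recurrence-at-1 zero zero = refl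
ways₁-recurrence-at-1 (suc zero) zero = refl
ways₁-recurrence-at-1 (suc (suc zero)) zero = refl
ways₁-recurrence-at-1 (suc (suc (suc k))) zero = refl
ways₁-recurrence-at-1 k (suc n) = ways₁-recurrence k 1 n

theorem7 : (n : ℕ) → 1 ≤ n → (k : ℤ) →
    d k (suc n) ≡ (d (k -ℤ + 1) n +ℤ + 2 *ℤ d k n) -ℤ d k (n ∸ 1)
theorem7 (suc n) _ -[1+ _ ] = refl
theorem7 (suc n) _ (+ k) = begin
  d (+ k) (suc (suc n))
    ≡⟨ d≡ways₁ k (suc (suc n)) ⟩
  + ways₁ k 1 (suc n)
    ≡⟨ m+n≡o⇒+m≡+o-+n (ways₁-recurrence-at-1 k n) ⟩
  + (fewer + 2 * current) -ℤ + earlier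
    ≡⟨ cong (_-ℤ + earlier) (trans (pos-+ fewer (2 * current)) (cong (+ fewer +ℤ_) (pos-* 2 current))) ⟩
  (+ fewer +ℤ + 2 *ℤ + current) -ℤ + earlier
    ≡⟨ cong₂ (λ x y → (x +ℤ + 2 *ℤ y) -ℤ + earlier) (d-previous≡ways₁ k n) (d≡ways₁ k (suc n)) ⟨
  (d (+ k -ℤ + 1) (suc n) +ℤ + 2 *ℤ d (+ k) (suc n)) -ℤ + earlier
    ≡⟨ cong (d (+ k -ℤ + 1) (suc n) +ℤ + 2 *ℤ d (+ k) (suc n) -ℤ_) (d≡ways₁ k n) ⟨
  (d (+ k -ℤ + 1) (suc n) +ℤ + 2 *ℤ d (+ k) (suc n)) -ℤ d (+ k) n ∎
  where
  open ≡-Reasoning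
  fewer current earlier : ℕ
  fewer = ways₁ k 2 n
  current = ways₁ k 1 n
  earlier = ways₁ k 1 (n ∸ 1)
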